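{- Let $G$ be a ringed tree of depth $h$ and let $1\le \ell\le h$. Let $u_1,u_2,\dots,u_{2^\ell}$ be the vertices of level $\ell$ in their cyclic order along the level-$\ell$ cycle. Then for every tree-decomposition $(T,\phi)$ of $G$ there exists a node $w\in V(T)$ and vertices $u_i,u_j\in\phi^{ -1}(w)$ with $i<j$ such that $\min\{j-i,\ 2^\ell+i-j\}\ge 2^{\ell-2}$.
   Context: A ringed tree of depth $h$ is obtained from the complete binary tree of depth $h$ (root at level $0$, level $\ell$ having $2^\ell$ vertices, drawn in the plane) by joining, for each level $\ell\ge1$, consecutive vertices of that level in their left-to-right order cyclically, so that the vertices of each level form a cycle. A tree-decomposition of a graph $G$ is a tree $T$ together with a map $\phi$ assigning to each vertex $x\in V(G)$ a (nonempty) subtree $\phi(x)$ of $T$ such that $\phi(x)\cap\phi(y)\neq\emptyset$ whenever $xy\in E(G)$; for a node $t\in V(T)$, $\phi^{ -1}(t)=\{x\in V(G): t\in\phi(x)\}$. -}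

module Defs where

open import Data.Nat using (ℕ; zero; suc; _+_; _*_; _∸_; _^_; _≤_; _<_)
open import Data.Fin using (Fin)
open import Data.List using (List; []; _∷_; _++_; length)
open import Data.List.Relation.Unary.Unique.Propositional using (Unique)
open import Data.Product using (Σ; _×_; _,_; ∃-syntax)
open import Data.Sum using (_⊎_)
open import Data.Unit using (⊤)
open import Data.Empty using (⊥)
open import Relation.Nullary using (¬_)
open import Relation.Binary.PropositionalEquality using (_≡_)

-- Ringed tree of depth h.
-- A vertex is (level ℓ, index i) with ℓ ≤ h and i < 2^ℓ; index i is the
-- (i+1)-st vertex of level ℓ in left-to-right order.

record RVertex (h : ℕ) : Set where
  constructor rv
  field
    lvl   : ℕ
    idx   : ℕ
    lvl≤h : lvl ≤ h
    idx<  : idx < 2 ^ lvl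

open RVertex public

-- Edges of the ringed tree (each undirected edge listed in one direction;
-- tree-decomposition conditions are symmetric anyway).
data RingedEdge (h : ℕ) : RVertex h → RVertex h → Set where
  leftChild  : (u v : RVertex h) → lvl v ≡ suc (lvl u) →
               idx v ≡ 2 * idx u → RingedEdge h u v
  rightChild : (u v : RVertex h) → lvl v ≡ suc (lvl u) →
               idx v ≡ suc (2 * idx u) → RingedEdge h u v
  ringNext   : (u v : RVertex h) → 1 ≤ lvl u → lvl v ≡ lvl u →
               idx v ≡ suc (idx u) → RingedEdge h u v
  ringWrap   : (u v : RVertex h) → 1 ≤ lvl u → lvl v ≡ lvl u →
               suc (idx u) ≡ 2 ^ lvl u → idx v ≡ 0 → RingedEdge h u v

data WalkIn {m : ℕ} (adj : Fin m → Fin m → Set) (P : Fin m → Set)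
       : Fin m → Fin m → Set where
  here  : ∀ {a} → P a → WalkIn adj P a a
  there : ∀ {a b c} → P a → adj a b → WalkIn adj P b c → WalkIn adj P a c

ConnectedSubset : {m : ℕ} → (Fin m → Fin m → Set) → (Fin m → Set) → Set
ConnectedSubset adj P = ∀ a b → P a → P b → WalkIn adj P a b

Chain : {m : ℕ} → (Fin m → Fin m → Set) → List (Fin m) → Set
Chain adj []           = ⊤
Chain adj (a ∷ [])     = ⊤
Chain adj (a ∷ b ∷ vs) = adj a b × Chain adj (b ∷ vs)

IsCycle : {m : ℕ} → (Fin m → Fin m → Set) → List (Fin m) → Set
IsCycle adj []       = ⊥
IsCycle adj (v ∷ vs) = 2 ≤ length vs × Unique (v ∷ vs) × Chain adj (v ∷ vs ++ v ∷ [])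

record Tree : Set₁ where
  field
    size      : ℕ
    Adj       : Fin size → Fin size → Set
    symmetric : ∀ a b → Adj a b → Adj b a
    loopless  : ∀ a → ¬ Adj a a
    connected : ConnectedSubset Adj (λ _ → ⊤)
    acyclic   : ∀ vs → ¬ IsCycle Adj vs

open Tree public

Node : Tree → Set
Node T = Fin (size T)

IsSubtree : (T : Tree) → (Node T → Set) → Set
IsSubtree T P = (∃[ t ] P t) × ConnectedSubset (Adj T) P

record TreeDecomposition (h : ℕ) : Set₁ where
  field
    T       : Tree
    φ       : RVertex h → Node T → Set    -- t ∈ φ(x)
    subtree : ∀ x → IsSubtree T (φ x)
    edges   : ∀ x y → RingedEdge h x y → ∃[ t ] (φ x t × φ y t)

open TreeDecomposition public

module Submission where

-- Fix a level ℓ of the ringed tree, with n = 2^ℓ vertices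
-- 0,…,n-1 on its cycle, and put q = 2^(ℓ-2) (the case ℓ = 1 is immediate:
-- the two vertices of level 1 are adjacent, hence share a bag).  Cut the
-- cycle into three arcs [0,q], [q,2q] and [2q,n-1].  Consecutive vertices of
-- an arc are adjacent, so the union of the subtrees φ(u) over the vertices u
-- of an arc is a connected set of nodes of T; the three unions pairwise meet
-- (in bags containing q, 2q and the wrap-around edge n-1 — 0).  By the Helly
-- property of subtrees of a tree, some node w lies in all three unions, i.e.
-- its bag contains vertices k₁ ∈ [0,q], k₂ ∈ [q,2q], k₃ ∈ [2q,n-1], and
-- elementary arithmetic shows two of them are at cyclic distance ≥ q.

open import Defs
open import Data.Nat using (ℕ; zero; suc; _+_; _*_; _∸_; _^_; _≤_; _<_; _⊓_; z≤n; s≤s; _≤?_; _≤′_; ≤′-refl; ≤′-step)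
open import Data.Nat.Properties
open import Data.Nat.Tactic.RingSolver using (solve-∀)
open import Data.Product using (Σ; _×_; ∃-syntax; _,_; proj₁; proj₂)
open import Data.Sum using (_⊎_; inj₁; inj₂)
open import Data.Fin using (Fin) renaming (_≟_ to _≟ᶠ_)
open import Data.List using (List; []; _∷_; _++_)
open import Data.List.Relation.Unary.Any using () renaming (here to here∈; there to there∈)
open import Data.List.Relation.Unary.All as All using (All; []; _∷_)
open import Data.List.Relation.Unary.All.Properties using (¬Any⇒All¬)
open import Data.List.Relation.Unary.AllPairs using ([]; _∷_)
open import Data.List.Membership.Propositional using (_∈_)
open import Data.List.Relation.Unary.Unique.Propositional using (Unique)
open import Relation.Nullary using (¬_; yes; no)
open import Relation.Binary.PropositionalEquality using (_≡_; refl; sym; trans; cong; subst)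
open import Data.Empty using (⊥-elim)
open import Data.Unit using (⊤; tt)

module _ {m : ℕ} {adj : Fin m → Fin m → Set} where

  walkStart : ∀ {P : Fin m → Set} {a b} → WalkIn adj P a b → P a
  walkStart (here p)      = p
  walkStart (there p _ _) = p

  walkEnd : ∀ {P : Fin m → Set} {a b} → WalkIn adj P a b → P b
  walkEnd (here p)      = p
  walkEnd (there _ _ w) = walkEnd w

  walkMap : ∀ {P Q : Fin m → Set} {a b} →
            (∀ {t} → P t → Q t) → WalkIn adj P a b → WalkIn adj Q a b
  walkMap f (here p)      = here (f p)
  walkMap f (there p e w) = there (f p) e (walkMap f w)

  _++ʷ_ : ∀ {P : Fin m → Set} {a b c} →
          WalkIn adj P a b → WalkIn adj P b c → WalkIn adj P a c
  here _      ++ʷ w′ = w′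
  there p e w ++ʷ w′ = there p e (w ++ʷ w′)

-- Reduced walks in a tree and the Helly property for three subtrees

module ReducedWalks (Tr : Tree) where

  private
    V = Node Tr
    _~_ = Adj Tr

  data Walk : V → V → Set where
    stay : ∀ {a} → Walk a a
    step : ∀ {a b c} → a ~ b → Walk b c → Walk a c

  nodes : ∀ {a b} → Walk a b → List V
  nodes {a} stay       = a ∷ []
  nodes {a} (step _ w) = a ∷ nodes w

  endVisited : ∀ {a b} (w : Walk a b) → b ∈ nodes w
  endVisited stay       = here∈ refl
  endVisited (step _ w) = there∈ (endVisited w)

  NotBackTo : ∀ {b c} → V → Walk b c → Set
  NotBackTo a stay                 = ⊤
  NotBackTo a (step {b = d} _ _) = ¬ (a ≡ d)

  Reduced : ∀ {a b} → Walk a b → Set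
  Reduced stay             = ⊤
  Reduced {a} (step _ w) = NotBackTo a w × Reduced w

  -- Closing a walk into a cycle: if the walk w visits a, then a followed by
  -- the nodes of w strictly before a is a chain, closed by an edge a ~ b to
  -- the start b of w; its nodes are distinct whenever those of w are.
  module _ {a : V} where

    upTo : ∀ {b c} → (w : Walk b c) → a ∈ nodes w → List V
    upTo stay       (here∈ refl) = []
    upTo (step _ w) (here∈ refl) = []
    upTo {b} (step _ w) (there∈ a∈w) = b ∷ upTo w a∈w

    upTo-chain : ∀ {x b c} → x ~ b → (w : Walk b c) (a∈w : a ∈ nodes w) →
                 Chain _~_ (x ∷ upTo w a∈w ++ a ∷ [])
    upTo-chain e stay       (here∈ refl)  = e , tt
    upTo-chain e (step _ w) (here∈ refl)  = e , tt
    upTo-chain e (step e′ w) (there∈ a∈w) = e , upTo-chain e′ w a∈w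

    upTo-all : ∀ {b c} (Q : V → Set) (w : Walk b c) (a∈w : a ∈ nodes w) →
               All Q (nodes w) → All Q (upTo w a∈w)
    upTo-all Q stay       (here∈ refl) _          = []
    upTo-all Q (step _ w) (here∈ refl) _          = []
    upTo-all Q (step _ w) (there∈ a∈w) (q ∷ qs) = q ∷ upTo-all Q w a∈w qs

    upTo-unique : ∀ {b c} (w : Walk b c) (a∈w : a ∈ nodes w) →
                  Unique (nodes w) → Unique (a ∷ upTo w a∈w)
    upTo-unique stay       (here∈ refl) _ = [] ∷ []
    upTo-unique (step _ w) (here∈ refl) _ = [] ∷ []
    upTo-unique (step _ w) (there∈ a∈w) (b∉w ∷ u) with upTo-unique w a∈w u
    ... | a∉ ∷ u′ = ((λ a≡b → All.lookup b∉w a∈w (sym a≡b)) ∷ a∉) ∷ (upTo-all _ w a∈w b∉w ∷ u′)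

    -- Acyclicity: a walk with distinct nodes leaving b (adjacent to a) without
    -- stepping straight back to a never reaches a.
    noReturn : ∀ {b c} → a ~ b → (w : Walk b c) → NotBackTo a w → Unique (nodes w) →
               ¬ (a ∈ nodes w)
    noReturn a~b stay                  _  _ (here∈ refl) = loopless Tr _ a~b
    noReturn a~b (step _ _)            _  _ (here∈ refl) = loopless Tr _ a~b
    noReturn a~b (step _ stay)         nb _ (there∈ (here∈ refl)) = nb refl
    noReturn a~b (step _ (step _ _))   nb _ (there∈ (here∈ refl)) = nb refl
    noReturn a~b w@(step _ (step _ _)) _  u a∈w@(there∈ (there∈ _)) =
      acyclic Tr (a ∷ upTo w a∈w) (s≤s (s≤s z≤n) , upTo-unique w a∈w u , upTo-chain a~b w a∈w)

  reduced⇒unique : ∀ {a b} (w : Walk a b) → Reduced w → Unique (nodes w)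
  reduced⇒unique stay _ = [] ∷ []
  reduced⇒unique (step e w) (nb , red) =
    ¬Any⇒All¬ (nodes w) (noReturn e w nb (reduced⇒unique w red)) ∷ reduced⇒unique w red

  reducedClosed : ∀ {a j} (w : Walk a a) → Reduced w → j ∈ nodes w → j ≡ a
  reducedClosed stay _ (here∈ j≡a) = j≡a
  reducedClosed (step e w) red _ with reduced⇒unique (step e w) red
  ... | a∉w ∷ _ = ⊥-elim (All.lookup a∉w (endVisited w) refl)

  prepend : ∀ {x y z} → x ~ y → Walk y z → Walk x z
  prepend e stay = step e stay
  prepend {x} e (step {b = d} e′ w) with x ≟ᶠ d
  ... | yes refl = w
  ... | no _     = step e (step e′ w)

  prepend-reduced : ∀ {x y z} (e : x ~ y) (w : Walk y z) → Reduced w → Reduced (prepend e w)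
  prepend-reduced e stay _ = tt , tt
  prepend-reduced {x} e (step {b = d} e′ w) red with x ≟ᶠ d
  ... | yes refl = proj₂ red
  ... | no x≢d   = x≢d , red

  prepend-all : ∀ {Q : V → Set} {x y z} (e : x ~ y) (w : Walk y z) →
                Q x → All Q (nodes w) → All Q (nodes (prepend e w))
  prepend-all e stay qx qs = qx ∷ qs
  prepend-all {x = x} e (step {b = d} e′ w) qx qs with x ≟ᶠ d
  prepend-all e (step e′ w) qx (_ ∷ qs) | yes refl = qs
  prepend-all e (step e′ w) qx qs       | no _     = qx ∷ qs

  prepend-keeps : ∀ {x y z j} (e : x ~ y) (w : Walk y z) → j ∈ nodes w →
                  j ≡ y ⊎ j ∈ nodes (prepend e w)
  prepend-keeps e stay (here∈ j≡y) = inj₁ j≡y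
  prepend-keeps {x} e (step {b = d} e′ w) j∈ with x ≟ᶠ d
  prepend-keeps e (step e′ w) (here∈ j≡y) | yes refl = inj₁ j≡y
  prepend-keeps e (step e′ w) (there∈ j∈) | yes refl = inj₂ j∈
  prepend-keeps e (step e′ w) j∈          | no _     = inj₂ (there∈ j∈)

  prependAll : ∀ {P : V → Set} {x y z} → WalkIn _~_ P x y → Walk y z → Walk x z
  prependAll (here _)      w = w
  prependAll (there _ e u) w = prepend e (prependAll u w)

  prependAll-reduced : ∀ {P : V → Set} {x y z} (u : WalkIn _~_ P x y) (w : Walk y z) →
                       Reduced w → Reduced (prependAll u w)
  prependAll-reduced (here _)      w red = red
  prependAll-reduced (there _ e u) w red = prepend-reduced e _ (prependAll-reduced u w red)

  prependAll-all : ∀ {Q : V → Set} {x y z} (u : WalkIn _~_ Q x y) (w : Walk y z) →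
                   All Q (nodes w) → All Q (nodes (prependAll u w))
  prependAll-all (here _)       w qs = qs
  prependAll-all (there qx e u) w qs = prepend-all e _ qx (prependAll-all u w qs)

  -- A Q-node j of w either survives in prependAll u w, or it was cancelled,
  -- in which case it lies on u, and so the sets P and Q meet.
  prependAll-keeps : ∀ {P Q : V → Set} {x y z} (u : WalkIn _~_ P x y) (w : Walk y z) →
                     ∀ {j} → j ∈ nodes w → Q j →
                     (∃[ t ] (P t × Q t)) ⊎ (∃[ j′ ] (j′ ∈ nodes (prependAll u w) × Q j′))
  prependAll-keeps (here _) w j∈ qj = inj₂ (_ , j∈ , qj)
  prependAll-keeps (there px e u) w j∈ qj with prependAll-keeps u w j∈ qj
  ... | inj₁ meet = inj₁ meet
  ... | inj₂ (j′ , j′∈ , qj′) with prepend-keeps e (prependAll u w) j′∈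
  ...   | inj₁ refl = inj₁ (j′ , walkStart u , qj′)
  ...   | inj₂ j′∈′ = inj₂ (j′ , j′∈′ , qj′)

  -- `Split P Q w`: w runs inside P up to some node and inside Q from that
  -- node on.  Prepending P-walks preserves this, and the switching node lies
  -- in both P and Q.
  Split : (P Q : V → Set) → ∀ {a b} → Walk a b → Set
  Split P Q {a} stay       = P a × Q a
  Split P Q {a} (step _ w) = P a × (All Q (a ∷ nodes w) ⊎ Split P Q w)

  split-all : ∀ {P Q : V → Set} {a b} (w : Walk a b) → P a → All Q (nodes w) → Split P Q w
  split-all stay       p (q ∷ []) = p , q
  split-all (step _ w) p qs       = p , inj₁ qs

  prepend-split : ∀ {P Q : V → Set} {x y z} (e : x ~ y) (w : Walk y z) →
                  P x → Split P Q w → Split P Q (prepend e w)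
  prepend-split e stay px s = px , inj₂ s
  prepend-split {x = x} e (step {b = d} e′ w) px s with x ≟ᶠ d
  prepend-split e (step e′ w) px (_ , inj₁ (_ ∷ qs)) | yes refl = split-all w px qs
  prepend-split e (step e′ w) px (_ , inj₂ s)        | yes refl = s
  prepend-split e (step e′ w) px s                   | no _     = px , inj₂ s

  prependAll-split : ∀ {P Q : V → Set} {x y z} (u : WalkIn _~_ P x y) (w : Walk y z) →
                     Split P Q w → Split P Q (prependAll u w)
  prependAll-split (here _)       w s = s
  prependAll-split (there px e u) w s = prepend-split e _ px (prependAll-split u w s)

  switchNode : ∀ {P Q : V → Set} {a b} (w : Walk a b) → Split P Q w →
               ∃[ j ] (j ∈ nodes w × (P j × Q j))
  switchNode stay               (p , q)          = _ , here∈ refl , p , q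
  switchNode (step _ w)         (p , inj₁ (q ∷ _)) = _ , here∈ refl , p , q
  switchNode (step _ w)         (_ , inj₂ s) with switchNode w s
  ... | j , j∈ , pq = j , there∈ j∈ , pq

  -- A P-walk a → b followed by a reduced walk b → a through a Q-node:
  -- after cancellation the closed walk is trivial, so the Q-node was either
  -- cancelled against the P-walk or is a itself; either way P and Q meet.
  closingMeets : ∀ {P Q : V → Set} {a b} (u : WalkIn _~_ P a b) (w : Walk b a) →
                 Reduced w → ∀ {j} → j ∈ nodes w → Q j → ∃[ t ] (P t × Q t)
  closingMeets u w red j∈ qj with prependAll-keeps u w j∈ qj
  ... | inj₁ meet = meet
  ... | inj₂ (j′ , j′∈ , qj′) with reducedClosed (prependAll u w) (prependAll-reduced u w red) j′∈
  ...   | refl = j′ , walkStart u , qj′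

  helly : ∀ {P₁ P₂ P₃ : V → Set} {a b c} →
          WalkIn _~_ P₁ a b → WalkIn _~_ P₂ b c → WalkIn _~_ P₃ c a →
          ∃[ t ] (P₁ t × P₂ t × P₃ t)
  helly {P₁} {P₂} {P₃} {a} {b} {c} W₁ W₂ W₃ = fromSwitch (switchNode w₂₃ split₂₃)
    where
      w₃ : Walk c a
      w₃ = prependAll W₃ stay

      w₂₃ : Walk b a
      w₂₃ = prependAll W₂ w₃

      split₂₃ : Split P₂ P₃ w₂₃
      split₂₃ = prependAll-split W₂ w₃
                  (split-all w₃ (walkEnd W₂) (prependAll-all W₃ stay (walkEnd W₃ ∷ [])))

      reduced₂₃ : Reduced w₂₃
      reduced₂₃ = prependAll-reduced W₂ w₃ (prependAll-reduced W₃ stay tt)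

      fromSwitch : ∃[ j ] (j ∈ nodes w₂₃ × (P₂ j × P₃ j)) → ∃[ t ] (P₁ t × P₂ t × P₃ t)
      fromSwitch (j , j∈ , p₂₃) = closingMeets W₁ w₂₃ reduced₂₃ j∈ p₂₃

-- Three points on a cycle

CyclicallyFar : (n q i j : ℕ) → Set
CyclicallyFar n q i j = i < j × q ≤ (j ∸ i) ⊓ (n + i ∸ j)

cyclicallyFar : ∀ {n q i j} → 1 ≤ q → q + i ≤ j → q + j ≤ n + i → CyclicallyFar n q i j
cyclicallyFar {n} {q} {i} {j} 1≤q qi≤j qj≤ni =
  ≤-trans (+-monoˡ-≤ i 1≤q) qi≤j ,
  ⊓-glb (subst (_≤ j ∸ i) (m+n∸n≡m q i) (∸-monoˡ-≤ i qi≤j))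
        (subst (_≤ n + i ∸ j) (m+n∸n≡m q j) (∸-monoˡ-≤ j qj≤ni))

-- On a cycle of length n ≥ 3q, of three points k₁ ∈ [0,q], k₂ ∈ [q,2q] and
-- k₃ ∈ [2q,n), some two are at cyclic distance at least q: if neither
-- (k₁,k₂) nor (k₂,k₃) is far, then k₃ - k₁ < 2q ≤ n - q, so (k₁,k₃) is.
threePoints : ∀ {n q k₁ k₂ k₃} → 1 ≤ q → q + (q + q) ≤ n →
              k₁ ≤ q → q ≤ k₂ → k₂ ≤ q + q → q + q ≤ k₃ → k₃ < n →
              CyclicallyFar n q k₁ k₂ ⊎ CyclicallyFar n q k₂ k₃ ⊎ CyclicallyFar n q k₁ k₃
threePoints {n} {q} {k₁} {k₂} {k₃} 1≤q 3q≤n k₁≤q q≤k₂ k₂≤2q 2q≤k₃ k₃<n with q + k₁ ≤? k₂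
... | yes far₁₂ = inj₁ (cyclicallyFar 1≤q far₁₂
        (≤-trans (+-monoʳ-≤ q k₂≤2q) (≤-trans 3q≤n (m≤m+n n k₁))))
... | no near₁₂ with q + k₂ ≤? k₃
...   | yes far₂₃ = inj₂ (inj₁ (cyclicallyFar 1≤q far₂₃
          (subst (q + k₃ ≤_) (+-comm k₂ n) (+-mono-≤ q≤k₂ (<⇒≤ k₃<n)))))
...   | no near₂₃ = inj₂ (inj₂ (cyclicallyFar 1≤q (≤-trans (+-monoʳ-≤ q k₁≤q) 2q≤k₃)
          (≤-trans (+-monoʳ-≤ q k₃≤2q+k₁)
            (subst (_≤ n + k₁) (trans (+-assoc q (q + q) k₁) (cong (q +_) (+-assoc q q k₁)))
                   (+-monoˡ-≤ k₁ 3q≤n)))))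
  where
    k₃≤2q+k₁ : k₃ ≤ q + (q + k₁)
    k₃≤2q+k₁ = ≤-trans (<⇒≤ (≰⇒> near₂₃)) (+-monoʳ-≤ q (<⇒≤ (≰⇒> near₁₂)))

-- A level of the ringed tree in a tree-decomposition

module Level {h : ℕ} (D : TreeDecomposition h) (ℓ : ℕ) (1≤ℓ : 1 ≤ ℓ) (ℓ≤h : ℓ ≤ h) where

  open ReducedWalks (T D)

  private
    V = Node (T D)
    _~_ = Adj (T D)

  vertex : (k : ℕ) → k < 2 ^ ℓ → RVertex h
  vertex k k< = rv ℓ k ℓ≤h k<

  InBag : ℕ → V → Set
  InBag k t = Σ (k < 2 ^ ℓ) λ k< → φ D (vertex k k<) t

  InArc : ℕ → ℕ → V → Set
  InArc lo hi t = ∃[ k ] (lo ≤ k × k ≤ hi × InBag k t)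

  bagWalk : ∀ {k t s} → InBag k t → InBag k s → WalkIn _~_ (InBag k) t s
  bagWalk {k} {t} {s} (k< , kt) (k<′ , ks) =
    walkMap (k< ,_) (proj₂ (subtree D (vertex k k<)) t s kt
                      (subst (λ p → φ D (vertex k p) s) (<-irrelevant k<′ k<) ks))

  -- The union of the subtrees of the vertices of an arc is connected:
  -- consecutive vertices j, j+1 are adjacent, so their subtrees meet.
  arcWalk : ∀ {lo hi j t s} → lo ≤′ j → j ≤ hi → InBag lo t → InBag j s →
            WalkIn _~_ (InArc lo hi) t s
  arcWalk {lo} ≤′-refl lo≤hi bt bs =
    walkMap (λ b → lo , ≤-refl , lo≤hi , b) (bagWalk bt bs)
  arcWalk {lo} {hi} {suc j} (≤′-step lo≤′j) j+1≤hi bt (j+1< , bs)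
    with edges D (vertex j j<) (vertex (suc j) j+1<) (ringNext _ _ 1≤ℓ refl refl)
    where j< = <-trans (n<1+n j) j+1<
  ... | e , ej , ej+1 =
    arcWalk lo≤′j (≤-trans (n≤1+n j) j+1≤hi) bt (_ , ej)
    ++ʷ walkMap (λ b → suc j , ≤′⇒≤ (≤′-step lo≤′j) , j+1≤hi , b) (bagWalk (_ , ej+1) (j+1< , bs))

  FarPairInBag : ℕ → Set
  FarPairInBag q = ∃[ w ] ∃[ i ] ∃[ j ] Σ (i < j) λ _ → Σ (i < 2 ^ ℓ) λ i< → Σ (j < 2 ^ ℓ) λ j< →
    φ D (rv ℓ i ℓ≤h i<) w × φ D (rv ℓ j ℓ≤h j<) w × q ≤ (j ∸ i) ⊓ (2 ^ ℓ + i ∸ j)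

  farPairInBag : ∀ {q i j w} → CyclicallyFar (2 ^ ℓ) q i j → InBag i w → InBag j w → FarPairInBag q
  farPairInBag (i<j , far) (i< , iw) (j< , jw) = _ , _ , _ , i<j , i< , j< , iw , jw , far

  1<n : 1 < 2 ^ ℓ
  1<n = ^-monoʳ-≤ 2 1≤ℓ

  someBag : ∀ {k} → k < 2 ^ ℓ → ∃[ t ] InBag k t
  someBag {k} k< with proj₁ (subtree D (vertex k k<))
  ... | t , kt = t , k< , kt

  wrapBag : ∃[ t ] (InBag (2 ^ ℓ ∸ 1) t × InBag 0 t)
  wrapBag with edges D (vertex (2 ^ ℓ ∸ 1) last<) (vertex 0 (m^n>0 2 ℓ))
                       (ringWrap _ _ 1≤ℓ refl (m+[n∸m]≡n (m^n>0 2 ℓ)) refl)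
    where
      last< : 2 ^ ℓ ∸ 1 < 2 ^ ℓ
      last< = ≤-reflexive (m+[n∸m]≡n (m^n>0 2 ℓ))
  ... | t , last-t , first-t = t , (_ , last-t) , (_ , first-t)

  -- The arcs [0,q], [q,2q] and [2q,2^ℓ-1] pairwise share bags (at q, at 2q,
  -- and across the edge 2^ℓ-1 — 0), so by the Helly property one bag meets
  -- all three arcs, and two of its three vertices are far apart.
  farPair : ∀ {q} → 1 ≤ q → q + (q + q) ≤ 2 ^ ℓ → FarPairInBag q
  farPair {q} 1≤q 3q≤n = fromCommonBag (helly arc₁ arc₂ arc₃)
    where
      n-1 : ℕ
      n-1 = 2 ^ ℓ ∸ 1

      2q<n : q + q < 2 ^ ℓ
      2q<n = ≤-trans (+-monoˡ-≤ (q + q) 1≤q) 3q≤n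

      q<n : q < 2 ^ ℓ
      q<n = ≤-<-trans (m≤m+n q q) 2q<n

      2q≤n-1 : q + q ≤ n-1
      2q≤n-1 = ≤-pred (subst (q + q <_) (sym (m+[n∸m]≡n (m^n>0 2 ℓ))) 2q<n)

      a b c : V
      a = proj₁ wrapBag
      b = proj₁ (someBag q<n)
      c = proj₁ (someBag 2q<n)

      arc₁ : WalkIn _~_ (InArc 0 q) a b
      arc₁ = arcWalk z≤′n ≤-refl (proj₂ (proj₂ wrapBag)) (proj₂ (someBag q<n))

      arc₂ : WalkIn _~_ (InArc q (q + q)) b c
      arc₂ = arcWalk (≤⇒≤′ (m≤m+n q q)) ≤-refl (proj₂ (someBag q<n)) (proj₂ (someBag 2q<n))

      arc₃ : WalkIn _~_ (InArc (q + q) n-1) c a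
      arc₃ = arcWalk (≤⇒≤′ 2q≤n-1) ≤-refl (proj₂ (someBag 2q<n)) (proj₁ (proj₂ wrapBag))

      fromCommonBag : ∃[ w ] (InArc 0 q w × InArc q (q + q) w × InArc (q + q) n-1 w) →
                      FarPairInBag q
      fromCommonBag (w , (k₁ , _ , k₁≤q , b₁) , (k₂ , q≤k₂ , k₂≤2q , b₂) , (k₃ , 2q≤k₃ , _ , b₃))
        with threePoints 1≤q 3q≤n k₁≤q q≤k₂ k₂≤2q 2q≤k₃ (proj₁ b₃)
      ... | inj₁ far₁₂        = farPairInBag far₁₂ b₁ b₂
      ... | inj₂ (inj₁ far₂₃) = farPairInBag far₂₃ b₂ b₃
      ... | inj₂ (inj₂ far₁₃) = farPairInBag far₁₃ b₁ b₃

  -- Vertices 0 and 1 of the level are adjacent, hence share a bag, and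
  -- they are at cyclic distance 1 since the level has 2^ℓ ≥ 2 vertices.
  adjacentPair : FarPairInBag 1
  adjacentPair with edges D (vertex 0 (<-trans (s≤s z≤n) 1<n)) (vertex 1 1<n)
                            (ringNext _ _ 1≤ℓ refl refl)
  ... | w , 0w , 1w = farPairInBag (cyclicallyFar ≤-refl ≤-refl 2≤n+0) (_ , 0w) (_ , 1w)
    where
      2≤n+0 : 2 ≤ 2 ^ ℓ + 0
      2≤n+0 = subst (2 ≤_) (sym (+-identityʳ (2 ^ ℓ))) 1<n

threeQuarters : ∀ q → q + (q + q) ≤ 2 * (2 * q)
threeQuarters q = subst (q + (q + q) ≤_) (sym (fourTimes q)) (m≤n+m (q + (q + q)) q)
  where
    fourTimes : ∀ q → 2 * (2 * q) ≡ q + (q + (q + q))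
    fourTimes = solve-∀

-- Level 1 is handled by its adjacent pair; on level ℓ = m + 2 the bag found
-- by `farPair` with q = 2^m does the job, since 3·2^m ≤ 2^ℓ.
mainTheorem4 : (h ℓ : ℕ) → 1 ≤ ℓ → (ℓ≤h : ℓ ≤ h) → (D : TreeDecomposition h) →
    ∃[ w ] ∃[ i ] ∃[ j ] Σ (i < j) λ _ → Σ (i < 2 ^ ℓ) λ i< → Σ (j < 2 ^ ℓ) λ j< →
    φ D (rv ℓ i ℓ≤h i<) w × φ D (rv ℓ j ℓ≤h j<) w ×
    2 ^ (ℓ ∸ 2) ≤ (j ∸ i) ⊓ (2 ^ ℓ + i ∸ j)
mainTheorem4 h (suc zero)    1≤ℓ ℓ≤h D = Level.adjacentPair D 1 1≤ℓ ℓ≤h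
mainTheorem4 h (suc (suc m)) 1≤ℓ ℓ≤h D =
  Level.farPair D (suc (suc m)) 1≤ℓ ℓ≤h (m^n>0 2 m) (threeQuarters (2 ^ m))
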